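{- Let $\mathbf A,\mathbf B$ be finite algebras in $\mathcal V_3$ and $\mathbf S$ a subdirect subalgebra of $\mathbf A\times\mathbf B$ such that $\mathbf A$ is connected with respect to $\mathbf S$, and suppose $d(a,b)\le n$ for all $a,b\in A$. Let $m\ge\lfloor (n+1)/2\rfloor$ be an integer and $c\in A$. Then $\{a\in A: d(a,c)\le m\}$ is a Jónsson ideal of $\mathbf A$.
   Context: $\mathcal V_3$ is the class of algebras $(A;p_0,p_1,p_2,p_3)$ with ternary basic operations satisfying $p_0(x,y,z)=x$, $p_3(x,y,z)=z$, $p_i(x,y,x)=x$ for all $i$, $p_0(x,x,y)=p_1(x,x,y)$, $p_2(x,x,y)=p_3(x,x,y)$, $p_1(x,y,y)=p_2(x,y,y)$; $x\cdot y=p_1(x,y,y)$. A Jónsson ideal of $\mathbf A$ is a subuniverse $Y$ of $\mathbf A$ with $u\cdot y\in Y$ for all $y\in Y$, $u\in A$. Distance relative to $\mathbf S$: $S_0=0_A$, $S_1=\{(a,c):\exists b\in B,(a,b),(c,b)\in S\}$, $S_{k+1}=S_k\circ S_1$; $d(a,b)$ is the least $k$ with $(a,b)\in S_k$ (undefined if none); connected means $d$ is everywhere defined. -}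

module Defs where

open import Data.Nat using (ℕ; zero; suc; _≤_)
open import Data.Fin using (Fin)
open import Data.Product using (Σ; ∃; _×_; _,_)
open import Relation.Binary.PropositionalEquality using (_≡_)

record V3Algebra (k : ℕ) : Set where
  field
    p0 p1 p2 p3 : Fin k → Fin k → Fin k → Fin k
    p0-proj : ∀ x y z → p0 x y z ≡ x
    p3-proj : ∀ x y z → p3 x y z ≡ z
    p0-xyx : ∀ x y → p0 x y x ≡ x
    p1-xyx : ∀ x y → p1 x y x ≡ x
    p2-xyx : ∀ x y → p2 x y x ≡ x
    p3-xyx : ∀ x y → p3 x y x ≡ x
    p01 : ∀ x y → p0 x x y ≡ p1 x x y
    p23 : ∀ x y → p2 x x y ≡ p3 x x y
    p12 : ∀ x y → p1 x y y ≡ p2 x y y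

  _·_ : Fin k → Fin k → Fin k
  x · y = p1 x y y

open V3Algebra public

IsSubuniverse : ∀ {k} (A : V3Algebra k) → (Fin k → Set) → Set
IsSubuniverse A Y =
  (∀ x y z → Y x → Y y → Y z → Y (p0 A x y z)) ×
  (∀ x y z → Y x → Y y → Y z → Y (p1 A x y z)) ×
  (∀ x y z → Y x → Y y → Y z → Y (p2 A x y z)) ×
  (∀ x y z → Y x → Y y → Y z → Y (p3 A x y z))

IsJonssonIdeal : ∀ {k} (A : V3Algebra k) → (Fin k → Set) → Set
IsJonssonIdeal A Y = IsSubuniverse A Y × (∀ u y → Y y → Y (_·_ A u y))

IsSubuniverse× : ∀ {k l} (A : V3Algebra k) (B : V3Algebra l) →
                 (Fin k → Fin l → Set) → Set
IsSubuniverse× A B S =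
  (∀ a₁ a₂ a₃ b₁ b₂ b₃ → S a₁ b₁ → S a₂ b₂ → S a₃ b₃ →
     S (p0 A a₁ a₂ a₃) (p0 B b₁ b₂ b₃)) ×
  (∀ a₁ a₂ a₃ b₁ b₂ b₃ → S a₁ b₁ → S a₂ b₂ → S a₃ b₃ →
     S (p1 A a₁ a₂ a₃) (p1 B b₁ b₂ b₃)) ×
  (∀ a₁ a₂ a₃ b₁ b₂ b₃ → S a₁ b₁ → S a₂ b₂ → S a₃ b₃ →
     S (p2 A a₁ a₂ a₃) (p2 B b₁ b₂ b₃)) ×
  (∀ a₁ a₂ a₃ b₁ b₂ b₃ → S a₁ b₁ → S a₂ b₂ → S a₃ b₃ →
     S (p3 A a₁ a₂ a₃) (p3 B b₁ b₂ b₃))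

IsSubdirect : ∀ {k l} (A : V3Algebra k) (B : V3Algebra l) →
              (Fin k → Fin l → Set) → Set
IsSubdirect {k} {l} A B S =
  IsSubuniverse× A B S ×
  (∀ (a : Fin k) → ∃ λ (b : Fin l) → S a b) ×
  (∀ (b : Fin l) → ∃ λ (a : Fin k) → S a b)

S₁ : ∀ {k l} → (Fin k → Fin l → Set) → Fin k → Fin k → Set
S₁ {l = l} S a c = ∃ λ (b : Fin l) → S a b × S c b

Sₖ : ∀ {k l} → (Fin k → Fin l → Set) → ℕ → Fin k → Fin k → Set
Sₖ S zero a c = a ≡ c
Sₖ {k} S (suc j) a c = ∃ λ (b : Fin k) → Sₖ S j a b × S₁ S b c

-- d(a,c) ≤ m  (d(a,c) is defined and at most m): since d is the least j
-- with (a,c) ∈ S_j, this holds iff (a,c) ∈ S_j for some j ≤ m.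
dist≤ : ∀ {k l} → (Fin k → Fin l → Set) → Fin k → Fin k → ℕ → Set
dist≤ S a c m = ∃ λ j → j ≤ m × Sₖ S j a c

Connected : ∀ {k l} → (Fin k → Fin l → Set) → Set
Connected {k} S = ∀ (a b : Fin k) → ∃ λ j → Sₖ S j a b

-- Every basic operation acts componentwise on S and hence preserves each S_j;
-- since the operations are idempotent, the ball of radius m around c is a
-- subuniverse. For absorption write u · y = p₂(u,y,y). As d(u,y) ≤ n ≤ 2m there
-- is a midpoint z with d(u,z) ≤ m and d(z,y) ≤ m, so applying p₂ to the pairs
-- (u,z), (y,z), (y,c) gives (u · y, p₂(z,z,c)) ∈ S_m, and p₂(z,z,c) = p₃(z,z,c) = c.
module Submission where

open import Defs
open import Data.Nat using (ℕ; zero; suc; _+_; _≤_; z≤n; s≤s; ⌊_/2⌋; ⌈_/2⌉)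
open import Data.Nat.Properties
  using (≤-refl; ≤-trans; +-mono-≤; +-monoˡ-≤; ⌊n/2⌋≤⌈n/2⌉; ⌊n/2⌋+⌈n/2⌉≡n)
open import Data.Fin using (Fin)
open import Data.Product using (∃; _×_; _,_; proj₁; proj₂)
open import Relation.Binary.PropositionalEquality using (_≡_; refl; subst; subst₂; sym; trans)

Preserves₃ : ∀ {k l} → (Fin k → Fin l → Set) →
             (Fin k → Fin k → Fin k → Fin k) → (Fin l → Fin l → Fin l → Fin l) → Set
Preserves₃ S f g =
  ∀ {a₁ a₂ a₃ b₁ b₂ b₃} → S a₁ b₁ → S a₂ b₂ → S a₃ b₃ → S (f a₁ a₂ a₃) (g b₁ b₂ b₃)

module _ {k l} (S : Fin k → Fin l → Set) where

  S₁-sym : ∀ {a c} → S₁ S a c → S₁ S c a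
  S₁-sym (b , s , t) = b , t , s

  S₁-preserved : ∀ {f g} → Preserves₃ S f g →
                 ∀ {a₁ a₂ a₃ c₁ c₂ c₃} → S₁ S a₁ c₁ → S₁ S a₂ c₂ → S₁ S a₃ c₃ →
                 S₁ S (f a₁ a₂ a₃) (f c₁ c₂ c₃)
  S₁-preserved {g = g} fg (b₁ , s₁ , t₁) (b₂ , s₂ , t₂) (b₃ , s₃ , t₃) =
    g b₁ b₂ b₃ , fg s₁ s₂ s₃ , fg t₁ t₂ t₃

  Sₖ-preserved : ∀ {f g} → Preserves₃ S f g →
                 ∀ j {a₁ a₂ a₃ c₁ c₂ c₃} → Sₖ S j a₁ c₁ → Sₖ S j a₂ c₂ → Sₖ S j a₃ c₃ →
                 Sₖ S j (f a₁ a₂ a₃) (f c₁ c₂ c₃)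
  Sₖ-preserved fg zero refl refl refl = refl
  Sₖ-preserved {f} fg (suc j) (e₁ , p₁ , q₁) (e₂ , p₂ , q₂) (e₃ , p₃ , q₃) =
    f e₁ e₂ e₃ , Sₖ-preserved fg j p₁ p₂ p₃ , S₁-preserved fg q₁ q₂ q₃

  Sₖ-cons : ∀ j {a b c} → S₁ S a b → Sₖ S j b c → Sₖ S (suc j) a c
  Sₖ-cons zero q refl = _ , refl , q
  Sₖ-cons (suc j) q (e , p , r) = e , Sₖ-cons j q p , r

  Sₖ-sym : ∀ j {a c} → Sₖ S j a c → Sₖ S j c a
  Sₖ-sym zero refl = refl
  Sₖ-sym (suc j) (b , p , q) = Sₖ-cons j (S₁-sym q) (Sₖ-sym j p)

  Sₖ-split : ∀ i j {a c} → Sₖ S (j + i) a c → ∃ λ b → Sₖ S i a b × Sₖ S j b c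
  Sₖ-split i zero p = _ , p , refl
  Sₖ-split i (suc j) (e , p , q) with Sₖ-split i j p
  ... | b , r , s = b , r , (e , s , q)

  Sₖ⇒dist≤ : ∀ {a c m} → Sₖ S m a c → dist≤ S a c m
  Sₖ⇒dist≤ {m = m} p = m , ≤-refl , p

  module _ (left-total : ∀ a → ∃ λ b → S a b) where

    S₁-refl : ∀ a → S₁ S a a
    S₁-refl a with left-total a
    ... | b , s = b , s , s

    Sₖ-mono : ∀ {i j a c} → i ≤ j → Sₖ S i a c → Sₖ S j a c
    Sₖ-mono {zero} {zero} z≤n p = p
    Sₖ-mono {zero} {suc j} {c = c} z≤n p = c , Sₖ-mono {zero} {j} z≤n p , S₁-refl c
    Sₖ-mono {suc i} {suc j} (s≤s i≤j) (e , p , q) = e , Sₖ-mono i≤j p , q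

    dist≤⇒Sₖ : ∀ {a c m} → dist≤ S a c m → Sₖ S m a c
    dist≤⇒Sₖ (j , j≤m , p) = Sₖ-mono j≤m p

module _ {k l} (A : V3Algebra k) (B : V3Algebra l)
         (S : Fin k → Fin l → Set) (subdirect : IsSubdirect A B S) where

  private
    preserves : IsSubuniverse× A B S
    preserves = proj₁ subdirect

    left-total : ∀ a → ∃ λ b → S a b
    left-total = proj₁ (proj₂ subdirect)

    Ball : ℕ → Fin k → Fin k → Set
    Ball m c a = dist≤ S a c m

  ball-closed : ∀ {f g} → Preserves₃ S f g → ∀ m c → f c c c ≡ c →
                ∀ x y z → Ball m c x → Ball m c y → Ball m c z → Ball m c (f x y z)
  ball-closed {f} fg m c fccc≡c x y z bx by bz =
    Sₖ⇒dist≤ S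
      (subst (Sₖ S m (f x y z)) fccc≡c
        (Sₖ-preserved S fg m (dist≤⇒Sₖ S left-total bx)
                             (dist≤⇒Sₖ S left-total by)
                             (dist≤⇒Sₖ S left-total bz)))

  ball-subuniverse : ∀ m c → IsSubuniverse A (Ball m c)
  ball-subuniverse m c =
    let (pres₀ , pres₁ , pres₂ , pres₃) = preserves in
    ball-closed (pres₀ _ _ _ _ _ _) m c (p0-xyx A c c) ,
    ball-closed (pres₁ _ _ _ _ _ _) m c (p1-xyx A c c) ,
    ball-closed (pres₂ _ _ _ _ _ _) m c (p2-xyx A c c) ,
    ball-closed (pres₃ _ _ _ _ _ _) m c (p3-xyx A c c)

  ball-absorbing : ∀ n m → n ≤ m + m → (∀ a b → dist≤ S a b n) →
                   ∀ c u y → Ball m c y → Ball m c (_·_ A u y)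
  ball-absorbing n m n≤2m bounded c u y y∈ball =
    Sₖ⇒dist≤ S (subst₂ (Sₖ S m) (sym (p12 A u y)) p₂zzc≡c
                 (Sₖ-preserved S (pres₂ _ _ _ _ _ _) m uz (Sₖ-sym S m zy)
                                 (dist≤⇒Sₖ S left-total y∈ball)))
    where
    pres₂ : ∀ a₁ a₂ a₃ b₁ b₂ b₃ → S a₁ b₁ → S a₂ b₂ → S a₃ b₃ →
            S (p2 A a₁ a₂ a₃) (p2 B b₁ b₂ b₃)
    pres₂ = proj₁ (proj₂ (proj₂ preserves))

    midpoint : ∃ λ z → Sₖ S m u z × Sₖ S m z y
    midpoint = Sₖ-split S m m (Sₖ-mono S left-total n≤2m (dist≤⇒Sₖ S left-total (bounded u y)))

    z : Fin k
    z = proj₁ midpoint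

    uz : Sₖ S m u z
    uz = proj₁ (proj₂ midpoint)

    zy : Sₖ S m z y
    zy = proj₂ (proj₂ midpoint)

    p₂zzc≡c : p2 A z z c ≡ c
    p₂zzc≡c = trans (p23 A z c) (p3-proj A z z c)

n≤⌈n/2⌉+⌈n/2⌉ : ∀ n → n ≤ ⌈ n /2⌉ + ⌈ n /2⌉
n≤⌈n/2⌉+⌈n/2⌉ n =
  subst (_≤ ⌈ n /2⌉ + ⌈ n /2⌉) (⌊n/2⌋+⌈n/2⌉≡n n) (+-monoˡ-≤ ⌈ n /2⌉ (⌊n/2⌋≤⌈n/2⌉ n))

corollary3p6 : ∀ {k l} (A : V3Algebra k) (B : V3Algebra l)
    (S : Fin k → Fin l → Set) → IsSubdirect A B S → Connected S →
    (n : ℕ) → (∀ (a b : Fin k) → dist≤ S a b n) →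
    (m : ℕ) → ⌊ suc n /2⌋ ≤ m → (c : Fin k) →
    IsJonssonIdeal A (λ a → dist≤ S a c m)
corollary3p6 A B S subdirect _ n bounded m ⌈n/2⌉≤m c =
  ball-subuniverse A B S subdirect m c ,
  ball-absorbing A B S subdirect n m n≤2m bounded c
  where
  n≤2m : n ≤ m + m
  n≤2m = ≤-trans (n≤⌈n/2⌉+⌈n/2⌉ n) (+-mono-≤ ⌈n/2⌉≤m ⌈n/2⌉≤m)
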